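{- Let $n\geq 2$ be an integer, and write $p_{n+1} = k_n d_n + r_n$ with integers $k_n$ and $1\leq r_n < d_n$ (division of $p_{n+1}$ by $d_n$). Each of the following statements is equivalent to $d_n^2 < 2p_{n+1}$: (1) the smallest odd multiple of $p_{n+1}$ (i.e. number $m p_{n+1}$ with $m$ an odd integer) that is greater than $p_n^2$ is $(p_n-(d_n-2))p_{n+1}$; (2) $(d_n-2)p_{n+1}$ is the largest even multiple of $p_{n+1}$ that is at most $d_n p_n$; (3) $k_n \geq d_n/2$.
   Context: $p_n$ denotes the $n$th prime ($p_1=2$) and $d_n := p_{n+1}-p_n$ is the $n$th prime gap. -}

module Defs where

open import Data.Nat using (ℕ; suc; _+_; _*_; _≤_; _<_)
open import Data.Nat.Divisibility using (_∣_)
open import Data.Nat.Primality using (Prime; prime?)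
open import Data.List using (length; filter; upTo)
open import Data.Product using (Σ; _×_)
open import Relation.Nullary using (¬_)
open import Relation.Binary.PropositionalEquality using (_≡_)

primeCount : ℕ → ℕ
primeCount x = length (filter prime? (upTo (suc x)))

-- p is the n-th prime (p_1 = 2): p is prime and exactly n primes are ≤ p
IsNthPrime : ℕ → ℕ → Set
IsNthPrime n p = Prime p × primeCount p ≡ n

Even : ℕ → Set
Even m = 2 ∣ m

Odd : ℕ → Set
Odd m = ¬ (2 ∣ m)

IsLeast : (ℕ → Set) → ℕ → Set
IsLeast P x = P x × (∀ y → P y → x ≤ y)

IsGreatest : (ℕ → Set) → ℕ → Set
IsGreatest P x = P x × (∀ y → P y → y ≤ x)

OddMultipleAbove : ℕ → ℕ → ℕ → Set
OddMultipleAbove q bound y = Σ ℕ (λ m → Odd m × y ≡ m * q) × bound < y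

EvenMultipleAtMost : ℕ → ℕ → ℕ → Set
EvenMultipleAtMost q bound y = Σ ℕ (λ m → Even m × y ≡ m * q) × y ≤ bound

{-# OPTIONS --safe #-}
module Submission where

-- Both primes are odd, so d = q − p = 2 + e with e even, and each condition is
-- compared with d² < 2q through an identity. (1) For m = p − e one has
-- m q + d² = p² + 2q: hence m q > p² iff d² < 2q, while (m − 2) q ≤ p², so no
-- smaller odd multiple exceeds p² (if e > p, both sides fail). (2) e q + 2q = d p + d²,
-- so e q ≤ d p iff d² ≤ 2q, which is strict since d² ≡ 0 and 2q ≡ 2 (mod 4); and
-- (e + 2) q = d q > d p. (3) 2q = 2k d + 2r lies strictly between 2k d and (2k + 2) d,
-- and both d and 2k are even.

open import Defs
open import Data.Nat using (ℕ; zero; suc; _+_; _*_; _∸_; _≤_; _<_; _≤′_; ≤′-refl; ≤′-step; _≤?_; z<s)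
open import Data.Nat.Properties
open import Data.Nat.Divisibility using (divides; ∣-refl; ∣1⇒≡1; ∣m∣n⇒∣m+n; ∣m+n∣m⇒∣n; m∣m*n)
open import Data.Nat.Primality using (prime?; prime⇒irreducible)
open import Data.Nat.Tactic.RingSolver using (solve-∀)
open import Data.List using (length; filter; upTo; [_]; _++_)
open import Data.List.Properties using (length-++; filter-++; upTo-∷ʳ)
open import Data.Product using (∃-syntax; _×_; _,_; proj₁; proj₂)
open import Data.Sum using (inj₁; inj₂)
open import Function.Base using (_∘_)
open import Function.Bundles using (_⇔_; mk⇔)
open import Function.Construct.Composition using (_⇔-∘_)
open import Relation.Nullary using (yes; no; contradiction)
open import Relation.Binary.PropositionalEquality using (_≡_; _≢_; refl; sym; trans; cong; subst)

even-2+ : ∀ {n} → Even n → Even (2 + n)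
even-2+ = ∣m∣n⇒∣m+n ∣-refl

even⇒odd-suc : ∀ {n} → Even n → Odd (suc n)
even⇒odd-suc {n} n-even 1+n-even
  with () ← ∣1⇒≡1 (∣m+n∣m⇒∣n (subst Even (+-comm 1 n) 1+n-even) n-even)

odd⇒even-suc : ∀ {n} → Odd n → Even (suc n)
odd⇒even-suc {zero}        0-odd = contradiction (divides 0 refl) 0-odd
odd⇒even-suc {suc zero}    _     = ∣-refl
odd⇒even-suc {suc (suc n)} odd   = even-2+ (odd⇒even-suc (odd ∘ even-2+))

even-<⇒2+≤ : ∀ {m n} → Even m → Even n → m < n → 2 + m ≤ n
even-<⇒2+≤ m-even n-even m<n with m≤n⇒m<n∨m≡n m<n
... | inj₁ 1+m<n = 1+m<n
... | inj₂ refl  = contradiction n-even (even⇒odd-suc m-even)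

odd-<⇒2+≤ : ∀ {m n} → Odd m → Odd n → m < n → 2 + m ≤ n
odd-<⇒2+≤ m-odd n-odd m<n with m≤n⇒m<n∨m≡n m<n
... | inj₁ 1+m<n = 1+m<n
... | inj₂ refl  = contradiction (odd⇒even-suc m-odd) n-odd

square-of-even≢twice-odd : ∀ {d q} → Even d → Odd q → d * d ≢ 2 * q
square-of-even≢twice-odd {q = q} (divides j refl) q-odd dd≡2q =
  q-odd (divides (j * j) (sym (*-cancelˡ-≡ (j * j * 2) q 2 (trans (sym (square j)) dd≡2q))))
  where
  square : ∀ j → j * 2 * (j * 2) ≡ 2 * (j * j * 2)
  square = solve-∀

+-balance-< : ∀ {x y z w} → x + y ≡ z + w → (y < w ⇔ z < x)
+-balance-< {x} {y} {z} {w} x+y≡z+w = mk⇔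
  (λ y<w → +-cancelʳ-< y z x (subst (z + y <_) (sym x+y≡z+w) (+-monoʳ-< z y<w)))
  (λ z<x → +-cancelˡ-< z y w (subst (z + y <_) x+y≡z+w (+-monoˡ-< y z<x)))

+-balance-≤ : ∀ {x y z w} → x + y ≡ z + w → (w ≤ y ⇔ x ≤ z)
+-balance-≤ {x} {y} {z} {w} x+y≡z+w = mk⇔
  (λ w≤y → +-cancelʳ-≤ y x z (subst (_≤ z + y) (sym x+y≡z+w) (+-monoʳ-≤ z w≤y)))
  (λ x≤z → +-cancelˡ-≤ z w y (subst (_≤ z + y) x+y≡z+w (+-monoˡ-≤ y x≤z)))

isLeast-oddMultipleAbove⇔ : ∀ {q b m} → Odd m → m * q ≤ 2 * q + b →
  (b < m * q ⇔ IsLeast (OddMultipleAbove q b) (m * q))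
isLeast-oddMultipleAbove⇔ {q} {b} {m} m-odd mq≤2q+b = mk⇔ least (proj₂ ∘ proj₁)
  where
  below-m : ∀ {m′} → Odd m′ → m′ < m → m′ * q ≤ b
  below-m {m′} m′-odd m′<m = +-cancelˡ-≤ (2 * q) (m′ * q) b (begin
    2 * q + m′ * q ≡⟨ *-distribʳ-+ q 2 m′ ⟨
    (2 + m′) * q   ≤⟨ *-monoˡ-≤ q (odd-<⇒2+≤ m′-odd m-odd m′<m) ⟩
    m * q          ≤⟨ mq≤2q+b ⟩
    2 * q + b      ∎)
    where open ≤-Reasoning

  least : b < m * q → IsLeast (OddMultipleAbove q b) (m * q)
  least b<mq = ((m , m-odd , refl) , b<mq) , λ where
    _ ((m′ , m′-odd , refl) , b<m′q) →
      *-monoˡ-≤ q (≮⇒≥ (λ m′<m → <⇒≱ b<m′q (below-m m′-odd m′<m)))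

isGreatest-evenMultipleAtMost⇔ : ∀ {q b m} → Even m → b < (2 + m) * q →
  (m * q ≤ b ⇔ IsGreatest (EvenMultipleAtMost q b) (m * q))
isGreatest-evenMultipleAtMost⇔ {q} {b} {m} m-even b<[2+m]q = mk⇔ greatest (proj₂ ∘ proj₁)
  where
  greatest : m * q ≤ b → IsGreatest (EvenMultipleAtMost q b) (m * q)
  greatest mq≤b = ((m , m-even , refl) , mq≤b) , λ where
    _ ((m′ , m′-even , refl) , m′q≤b) →
      *-monoˡ-≤ q (≮⇒≥ (λ m<m′ →
        <⇒≱ b<[2+m]q (≤-trans (*-monoˡ-≤ q (even-<⇒2+≤ m-even m′-even m<m′)) m′q≤b)))

quotient-criterion : ∀ {d q k r} → Even d → q ≡ k * d + r → 0 < r → r < d →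
  (d * d < 2 * q ⇔ d ≤ 2 * k)
quotient-criterion {d} {_} {k} {r} d-even refl 0<r r<d = mk⇔ to from
  where
  open ≤-Reasoning

  twice-sum : ∀ k d → 2 * (k * d + d) ≡ (2 + 2 * k) * d
  twice-sum = solve-∀

  from : d ≤ 2 * k → d * d < 2 * (k * d + r)
  from d≤2k = begin-strict
    d * d           ≤⟨ *-monoˡ-≤ d d≤2k ⟩
    2 * k * d       ≡⟨ *-assoc 2 k d ⟩
    2 * (k * d)     <⟨ *-monoʳ-< 2 (m<m+n (k * d) 0<r) ⟩
    2 * (k * d + r) ∎

  above : 2 * k < d → 2 * (k * d + r) < d * d
  above 2k<d = begin-strict
    2 * (k * d + r) <⟨ *-monoʳ-< 2 (+-monoʳ-< (k * d) r<d) ⟩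
    2 * (k * d + d) ≡⟨ twice-sum k d ⟩
    (2 + 2 * k) * d ≤⟨ *-monoˡ-≤ d (even-<⇒2+≤ (m∣m*n k) d-even 2k<d) ⟩
    d * d           ∎

  to : d * d < 2 * (k * d + r) → d ≤ 2 * k
  to dd<2q = ≮⇒≥ (λ 2k<d → <-asym dd<2q (above 2k<d))

evenMultiple-criterion : ∀ {p e q} → Odd q → Even e → p + (2 + e) ≡ q →
  ((2 + e) * (2 + e) < 2 * q ⇔ IsGreatest (EvenMultipleAtMost q ((2 + e) * p)) (e * q))
evenMultiple-criterion {p} {e} q-odd e-even refl =
  isGreatest-evenMultipleAtMost⇔ e-even dp<dq ⇔-∘ (+-balance-≤ (identity p e) ⇔-∘ <⇔≤)
  where
  d = 2 + e
  q = p + d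

  identity : ∀ p e → e * (p + (2 + e)) + 2 * (p + (2 + e)) ≡ (2 + e) * p + (2 + e) * (2 + e)
  identity = solve-∀

  dp<dq : d * p < d * q
  dp<dq = *-monoʳ-< d (m<m+n p z<s)

  <⇔≤ : d * d < 2 * q ⇔ d * d ≤ 2 * q
  <⇔≤ = mk⇔ <⇒≤ (λ dd≤2q → ≤∧≢⇒< dd≤2q (square-of-even≢twice-odd (even-2+ e-even) q-odd))

oddMultiple-criterion : ∀ {p e q} → Odd p → Even e → p + (2 + e) ≡ q →
  ((2 + e) * (2 + e) < 2 * q ⇔ IsLeast (OddMultipleAbove q (p * p)) ((p ∸ e) * q))
oddMultiple-criterion {p} {e} p-odd e-even refl with e ≤? p
... | yes e≤p with m , refl ← m≤n⇒∃[o]m+o≡n e≤p rewrite m+n∸m≡n e m =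
  isLeast-oddMultipleAbove⇔ m-odd mq≤2q+pp ⇔-∘ +-balance-< (identity e m)
  where
  d = 2 + e
  q = e + m + d

  m-odd : Odd m
  m-odd m-even = p-odd (∣m∣n⇒∣m+n e-even m-even)

  identity : ∀ e m →
    m * (e + m + (2 + e)) + (2 + e) * (2 + e) ≡ (e + m) * (e + m) + 2 * (e + m + (2 + e))
  identity = solve-∀

  mq≤2q+pp : m * q ≤ 2 * q + (e + m) * (e + m)
  mq≤2q+pp = ≤-trans (m≤m+n (m * q) (d * d)) (≤-reflexive (trans (identity e m) (+-comm _ (2 * q))))
... | no e≰p rewrite m≤n⇒m∸n≡0 (<⇒≤ (≰⇒> e≰p)) = mk⇔
  (λ dd<2q → contradiction 2q<dd (<-asym dd<2q))
  (λ least → contradiction (proj₂ (proj₁ least)) n≮0)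
  where
  open ≤-Reasoning

  square : ∀ e → 2 * (e + (2 + e)) + e * e ≡ (2 + e) * (2 + e)
  square = solve-∀

  2q<dd : 2 * (p + (2 + e)) < (2 + e) * (2 + e)
  2q<dd = begin-strict
    2 * (p + (2 + e))         <⟨ *-monoʳ-< 2 (+-monoˡ-< (2 + e) (≰⇒> e≰p)) ⟩
    2 * (e + (2 + e))         ≤⟨ m≤m+n _ (e * e) ⟩
    2 * (e + (2 + e)) + e * e ≡⟨ square e ⟩
    (2 + e) * (2 + e)         ∎

primeCount-≤-suc : ∀ x → primeCount x ≤ primeCount (suc x)
primeCount-≤-suc x = begin
  primeCount x                                          ≤⟨ m≤m+n _ _ ⟩
  length primes + length (filter prime? [ suc x ])      ≡⟨ length-++ primes ⟨
  length (primes ++ filter prime? [ suc x ])            ≡⟨ cong length (filter-++ prime? (upTo (suc x)) [ suc x ]) ⟨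
  length (filter prime? (upTo (suc x) ++ [ suc x ]))    ≡⟨ cong (length ∘ filter prime?) (upTo-∷ʳ (suc x)) ⟩
  primeCount (suc x)                                    ∎
  where
  open ≤-Reasoning
  primes = filter prime? (upTo (suc x))

primeCount-mono : ∀ {x y} → x ≤ y → primeCount x ≤ primeCount y
primeCount-mono = mono ∘ ≤⇒≤′
  where
  mono : ∀ {x y} → x ≤′ y → primeCount x ≤ primeCount y
  mono ≤′-refl                   = ≤-refl
  mono {y = suc y} (≤′-step x≤′y) = ≤-trans (mono x≤′y) (primeCount-≤-suc y)

nthPrime-odd : ∀ {n p} → 2 ≤ n → IsNthPrime n p → Odd p
nthPrime-odd 2≤n (p-prime , refl) p-even with prime⇒irreducible p-prime p-even
... | inj₂ refl = 1+n≰n 2≤n  -- primeCount 2 evaluates to 1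

nthPrime-< : ∀ {n p q} → IsNthPrime n p → IsNthPrime (n + 1) q → p < q
nthPrime-< {p = p} (_ , refl) (_ , πq≡πp+1) =
  ≰⇒> (λ q≤p → m+1+n≰m (primeCount p) (subst (_≤ primeCount p) πq≡πp+1 (primeCount-mono q≤p)))

-- The gap is returned as 2 + e so that the statement's (q ∸ p) ∸ 2 reduces to e.
odd-gap : ∀ {p q} → Odd p → Odd q → p < q → ∃[ e ] Even e × p + (2 + e) ≡ q
odd-gap {p} p-odd q-odd p<q with e , refl ← m≤n⇒∃[o]m+o≡n (odd-<⇒2+≤ p-odd q-odd p<q) =
  e , e-even , p+[2+e]≡2+p+e
  where
  p+[2+e]≡2+p+e : p + (2 + e) ≡ 2 + p + e
  p+[2+e]≡2+p+e = trans (sym (+-assoc p 2 e)) (cong (_+ e) (+-comm p 2))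

  e-even : Even e
  e-even = ∣m+n∣m⇒∣n (∣m+n∣m⇒∣n (subst Even (cong suc (sym p+[2+e]≡2+p+e)) (odd⇒even-suc q-odd))
                                (odd⇒even-suc p-odd))
                     ∣-refl

theorem1p6 : (n p q : ℕ) → 2 ≤ n → IsNthPrime n p → IsNthPrime (n + 1) q →
    ((q ∸ p) * (q ∸ p) < 2 * q ⇔ IsLeast (OddMultipleAbove q (p * p)) ((p ∸ ((q ∸ p) ∸ 2)) * q))
    × ((q ∸ p) * (q ∸ p) < 2 * q ⇔ IsGreatest (EvenMultipleAtMost q ((q ∸ p) * p)) (((q ∸ p) ∸ 2) * q))
    × ((k r : ℕ) → q ≡ k * (q ∸ p) + r → 1 ≤ r → r < q ∸ p →
    ((q ∸ p) * (q ∸ p) < 2 * q ⇔ q ∸ p ≤ 2 * k))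
theorem1p6 n p q 2≤n p-nth q-nth
  with p-odd ← nthPrime-odd 2≤n p-nth
  with q-odd ← nthPrime-odd (m≤n⇒m≤n+o 1 2≤n) q-nth
  with e , e-even , refl ← odd-gap p-odd q-odd (nthPrime-< p-nth q-nth)
  rewrite m+n∸m≡n p (2 + e) =
    oddMultiple-criterion p-odd e-even refl ,
    evenMultiple-criterion q-odd e-even refl ,
    λ k _ → quotient-criterion {k = k} (even-2+ e-even)
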